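{- Let $(c_1,\ldots,c_k)$ be a sequence of positive integers with $c_1=1$. Then there exist $\prod_{i=2}^{k}\binom{c_i-1}{i-2}$ distinct $k\times k$ upper triangular matrices $B$ with nonnegative integer entries and ones on the diagonal such that, setting $A=I-B^{ -1}$ (a strictly upper triangular integer matrix), the set $P_A$ has weight generating function \[\sum_{\lambda\in P_A}q^{\lambda_1+\cdots+\lambda_k}=\prod_{i=1}^k\frac{1}{1-q^{c_i}}.\]
   Context: For a $k\times k$ strictly upper triangular integer matrix $A$, $P_A$ denotes the set of integer sequences $(\lambda_1,\ldots,\lambda_k)$ satisfying $\lambda_i\ge\sum_{j=i+1}^kA[i,j]\lambda_j$ for $1\le i\le k$. $I$ is the identity matrix. -}

module Defs where

open import Data.Nat as ℕ using (ℕ; zero; suc; _∸_)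
open import Data.Nat.Combinatorics using (_C_)
open import Data.Integer as ℤ using (ℤ; +_)
open import Data.Fin as Fin using (Fin; zero; suc; toℕ)
open import Data.Vec using (Vec; lookup)
open import Data.List using (List; length)
open import Data.List.Relation.Unary.Unique.Propositional using (Unique)
open import Data.List.Membership.Propositional using (_∈_)
open import Data.Product using (Σ; _×_)
open import Data.Bool using (if_then_else_)
open import Relation.Nullary.Decidable using (⌊_⌋)
open import Relation.Binary.PropositionalEquality using (_≡_)
open import Function.Bundles using (_⇔_)

-- square k×k matrices, indices 0..k-1 (paper's index i is our i-1)
Matrix : Set → ℕ → Set
Matrix A n = Fin n → Fin n → A

sumℤ : ∀ {n} → (Fin n → ℤ) → ℤ
sumℤ {zero} f = + 0
sumℤ {suc n} f = f zero ℤ.+ sumℤ (λ j → f (suc j))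

sumℕ : ∀ {n} → (Fin n → ℕ) → ℕ
sumℕ {zero} f = 0
sumℕ {suc n} f = f zero ℕ.+ sumℕ (λ j → f (suc j))

prodℕ : ∀ {n} → (Fin n → ℕ) → ℕ
prodℕ {zero} f = 1
prodℕ {suc n} f = f zero ℕ.* prodℕ (λ j → f (suc j))

_⊗_ : ∀ {n} → Matrix ℤ n → Matrix ℤ n → Matrix ℤ n
(M ⊗ N) i j = sumℤ (λ l → M i l ℤ.* N l j)

idM : ∀ {n} → Matrix ℤ n
idM i j = if ⌊ i Fin.≟ j ⌋ then + 1 else + 0

_⊖_ : ∀ {n} → Matrix ℤ n → Matrix ℤ n → Matrix ℤ n
(M ⊖ N) i j = M i j ℤ.- N i j

toℤM : ∀ {n} → Matrix ℕ n → Matrix ℤ n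
toℤM B i j = + B i j

UpperUnitriangular : ∀ {n} → Matrix ℕ n → Set
UpperUnitriangular B = (∀ i j → toℕ j ℕ.< toℕ i → B i j ≡ 0) × (∀ i → B i i ≡ 1)

IsInverse : ∀ {n} → Matrix ℤ n → Matrix ℤ n → Set
IsInverse M N = (∀ i j → (M ⊗ N) i j ≡ idM i j) × (∀ i j → (N ⊗ M) i j ≡ idM i j)

InP : ∀ {n} → Matrix ℤ n → Vec ℤ n → Set
InP A lam = ∀ i → sumℤ (λ j → if ⌊ toℕ i ℕ.<? toℕ j ⌋ then A i j ℤ.* lookup lam j else + 0) ℤ.≤ lookup lam i

HasCard : {X : Set} → (X → Set) → ℕ → Set
HasCard {X} P m = Σ (List X) (λ xs → (length xs ≡ m) × (Unique xs × (∀ x → P x ⇔ (x ∈ xs))))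

-- Σ_{lam ∈ P_A} q^{|lam|} = Π_i 1/(1-q^{c_i}) as formal power series:
-- for every n the coefficient of q^n agrees; the coefficient on the left is the
-- (finite) number of lam ∈ P_A of weight n, on the right the number of
-- (m_1,…,m_k) ∈ ℕ^k with Σ c_i m_i = n.
GFEq : ∀ {n} → Matrix ℤ n → (Fin n → ℕ) → Set
GFEq {k} A c = ∀ (n : ℕ) → Σ ℕ (λ m →
  HasCard (λ (lam : Vec ℤ k) → InP A lam × (sumℤ (lookup lam) ≡ + n)) m ×
  HasCard (λ (mu : Vec ℕ k) → sumℕ (λ i → c i ℕ.* lookup mu i) ≡ n) m)

-- Π_{i=2}^{k} binom(c_i - 1, i - 2), with c indexed by Fin (suc k)
binomProd : ∀ {k} → (Fin (suc k) → ℕ) → ℕ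
binomProd {k} c = prodℕ (λ (j : Fin k) → (c (suc j) ∸ 1) C toℕ j)

{-# OPTIONS --safe #-}
module Submission where

-- If B is upper unitriangular with nonnegative entries and column sums c, then for
-- A = I - B⁻¹ the defining inequalities of P_A say exactly that B⁻¹λ ≥ 0, so
-- P_A = B ℕᵏ, and the weight of Bμ is Σⱼ cⱼ μⱼ. Hence the weight generating function
-- of P_A is Πⱼ 1/(1 - q^cⱼ). Such matrices are plentiful: column j + 1 may carry any
-- vector in rows 0, …, j with positive entries in rows 1, …, j summing to cⱼ₊₁ - 1,
-- and there are binom(cⱼ₊₁ - 1, j) of them, enumerated along Pascal's rule.

open import Defs
open import Data.Nat as ℕ using (ℕ; zero; suc; _∸_; _≤_; _<_; z≤n; s≤s; _<?_)
import Data.Nat.Properties as ℕP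
open import Data.Nat.Combinatorics using (_C_; nCk+nC[k+1]≡[n+1]C[k+1])
open import Data.Integer as ℤ using (ℤ; +_; -_; _+_; _*_; _-_; 0ℤ; 1ℤ; -1ℤ; ∣_∣)
open import Data.Integer.Tactic.RingSolver using (solve-∀)
import Data.Integer.Properties as ℤP
open import Algebra.Properties.Semiring.Sum ℤP.+-*-semiring
  using (sum; sum-cong-≗; ∑-comm; ∑-distrib-+; *-distribˡ-sum; *-distribʳ-sum)
open import Data.Fin using (Fin; zero; suc; toℕ; _≟_; splitAt; remQuot)
import Data.Fin.Properties as FinP
open import Data.Vec using (Vec; []; _∷_; lookup; tabulate)
import Data.Vec.Properties as VecP
open import Data.Vec.Functional using (Vector; updateAt)
open import Data.List as List using (List; map; filter; upTo; cartesianProductWith; length)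
import Data.List.Properties as ListP
open import Data.List.Membership.Propositional using (_∈_)
import Data.List.Membership.Propositional.Properties as ∈P
open import Data.List.Relation.Unary.Any using (here)
open import Data.List.Relation.Unary.Unique.Propositional using (Unique)
import Data.List.Relation.Unary.All as All
import Data.List.Relation.Unary.AllPairs as AllPairs
import Data.List.Relation.Unary.Unique.Propositional.Properties as UniqueP
open import Data.Product using (Σ; ∃; _×_; _,_; proj₁; proj₂)
open import Data.Sum using (_⊎_; inj₁; inj₂)
open import Data.Bool using (if_then_else_)
open import Function using (_∘_; _⇔_; mk⇔; Equivalence; Injective; Injection)
open import Function.Properties.Inverse using (↔⇒↣)
open import Relation.Nullary using (Dec; yes; no; contradiction)
open import Relation.Nullary.Decidable using (⌊_⌋)
open import Relation.Binary.PropositionalEquality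
open import Relation.Binary.PropositionalEquality.Properties using (subst-injective)

private variable
  n : ℕ

sumℤ≡sum : (f : Vector ℤ n) → sumℤ f ≡ sum f
sumℤ≡sum {zero} f = refl
sumℤ≡sum {suc n} f = cong (_+_ (f zero)) (sumℤ≡sum (f ∘ suc))

sumℤ-cong : {f g : Vector ℤ n} → f ≗ g → sumℤ f ≡ sumℤ g
sumℤ-cong {f = f} {g} f≗g rewrite sumℤ≡sum f | sumℤ≡sum g = sum-cong-≗ f≗g

sumℤ-distrib-+ : (f g : Vector ℤ n) → sumℤ (λ i → f i + g i) ≡ sumℤ f + sumℤ g
sumℤ-distrib-+ f g
  rewrite sumℤ≡sum (λ i → f i + g i) | sumℤ≡sum f | sumℤ≡sum g = ∑-distrib-+ f g

sumℤ-distribˡ : ∀ x (f : Vector ℤ n) → x * sumℤ f ≡ sumℤ (λ i → x * f i)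
sumℤ-distribˡ x f rewrite sumℤ≡sum f | sumℤ≡sum (λ i → x * f i) = *-distribˡ-sum x f

sumℤ-distribʳ : ∀ x (f : Vector ℤ n) → sumℤ f * x ≡ sumℤ (λ i → f i * x)
sumℤ-distribʳ x f rewrite sumℤ≡sum f | sumℤ≡sum (λ i → f i * x) = *-distribʳ-sum x f

sumℤ-comm : ∀ {m} (f : Fin m → Fin n → ℤ) →
            sumℤ (λ i → sumℤ (f i)) ≡ sumℤ (λ j → sumℤ (λ i → f i j))
sumℤ-comm f = begin
  sumℤ (λ i → sumℤ (f i))             ≡⟨ sumℤ-cong (sumℤ≡sum ∘ f) ⟩
  sumℤ (λ i → sum (f i))              ≡⟨ sumℤ≡sum (λ i → sum (f i)) ⟩
  sum (λ i → sum (f i))               ≡⟨ ∑-comm f ⟩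
  sum (λ j → sum (λ i → f i j))       ≡⟨ sumℤ≡sum (λ j → sum (λ i → f i j)) ⟨
  sumℤ (λ j → sum (λ i → f i j))      ≡⟨ sumℤ-cong (λ j → sumℤ≡sum (λ i → f i j)) ⟨
  sumℤ (λ j → sumℤ (λ i → f i j))     ∎
  where open ≡-Reasoning

sumℤ-neg : (f : Vector ℤ n) → - sumℤ f ≡ sumℤ (λ i → - f i)
sumℤ-neg f = begin
  - sumℤ f                  ≡⟨ ℤP.-1*i≡-i _ ⟨
  -1ℤ * sumℤ f              ≡⟨ sumℤ-distribˡ -1ℤ f ⟩
  sumℤ (λ i → -1ℤ * f i)    ≡⟨ sumℤ-cong (ℤP.-1*i≡-i ∘ f) ⟩
  sumℤ (λ i → - f i)        ∎
  where open ≡-Reasoning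

sumℤ-*-zeroʳ : (f : Vector ℤ n) → sumℤ (λ i → f i * 0ℤ) ≡ 0ℤ
sumℤ-*-zeroʳ f = trans (sym (sumℤ-distribʳ 0ℤ f)) (ℤP.*-zeroʳ (sumℤ f))

sumℤ-pos : (f : Vector ℕ n) → sumℤ (+_ ∘ f) ≡ + sumℕ f
sumℤ-pos {zero} f = refl
sumℤ-pos {suc n} f =
  trans (cong (_+_ (+ f zero)) (sumℤ-pos (f ∘ suc))) (sym (ℤP.pos-+ (f zero) _))

sumℕ-zero : sumℕ {n} (λ _ → 0) ≡ 0
sumℕ-zero {zero} = refl
sumℕ-zero {suc n} = sumℕ-zero {n}

infix 4 _≐_
infixr 7 _*ᵥ_

_≐_ : Matrix ℤ n → Matrix ℤ n → Set
M ≐ N = ∀ i j → M i j ≡ N i j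

_*ᵥ_ : Matrix ℤ n → Vector ℤ n → Vector ℤ n
(M *ᵥ v) i = sumℤ (λ j → M i j * v j)

idM-offdiag : {i j : Fin n} → i ≢ j → idM i j ≡ 0ℤ
idM-offdiag {i = i} {j} i≢j with i ≟ j
... | yes i≡j = contradiction i≡j i≢j
... | no _ = refl

idM-suc : (i j : Fin n) → idM (suc i) (suc j) ≡ idM i j
idM-suc i j with i ≟ j
... | yes _ = refl
... | no _ = refl

idM-sym : (i j : Fin n) → idM i j ≡ idM j i
idM-sym zero zero = refl
idM-sym zero (suc j) = refl
idM-sym (suc i) zero = refl
idM-sym (suc i) (suc j) = trans (idM-suc i j) (trans (idM-sym i j) (sym (idM-suc j i)))

*ᵥ-identityˡ : (v : Vector ℤ n) → idM *ᵥ v ≗ v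
*ᵥ-identityˡ {suc n} v zero = begin
  1ℤ * v zero + sumℤ (λ j → 0ℤ * v (suc j))
    ≡⟨ cong₂ _+_ (ℤP.*-identityˡ (v zero)) (sym (sumℤ-distribˡ 0ℤ (v ∘ suc))) ⟩
  v zero + 0ℤ * sumℤ (v ∘ suc)
    ≡⟨ ℤP.+-identityʳ _ ⟩
  v zero ∎
  where open ≡-Reasoning
*ᵥ-identityˡ {suc n} v (suc i) = begin
  0ℤ * v zero + sumℤ (λ j → idM (suc i) (suc j) * v (suc j))
    ≡⟨ ℤP.+-identityˡ _ ⟩
  sumℤ (λ j → idM (suc i) (suc j) * v (suc j))
    ≡⟨ sumℤ-cong (λ j → cong (_* v (suc j)) (idM-suc i j)) ⟩
  (idM *ᵥ v ∘ suc) i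
    ≡⟨ *ᵥ-identityˡ (v ∘ suc) i ⟩
  v (suc i) ∎
  where open ≡-Reasoning

*ᵥ-assoc : (M N : Matrix ℤ n) (v : Vector ℤ n) → M *ᵥ N *ᵥ v ≗ (M ⊗ N) *ᵥ v
*ᵥ-assoc M N v i = begin
  sumℤ (λ j → M i j * sumℤ (λ l → N j l * v l))
    ≡⟨ sumℤ-cong (λ j → sumℤ-distribˡ (M i j) (λ l → N j l * v l)) ⟩
  sumℤ (λ j → sumℤ (λ l → M i j * (N j l * v l)))
    ≡⟨ sumℤ-comm (λ j l → M i j * (N j l * v l)) ⟩
  sumℤ (λ l → sumℤ (λ j → M i j * (N j l * v l)))
    ≡⟨ sumℤ-cong (λ l → sumℤ-cong (λ j → ℤP.*-assoc (M i j) (N j l) (v l))) ⟨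
  sumℤ (λ l → sumℤ (λ j → M i j * N j l * v l))
    ≡⟨ sumℤ-cong (λ l → sumℤ-distribʳ (v l) (λ j → M i j * N j l)) ⟨
  sumℤ (λ l → (M ⊗ N) i l * v l) ∎
  where open ≡-Reasoning

⊗-assoc : (M N P : Matrix ℤ n) → (M ⊗ N) ⊗ P ≐ M ⊗ (N ⊗ P)
⊗-assoc M N P i j = sym (*ᵥ-assoc M N (λ l → P l j) i)

⊗-identityˡ : (M : Matrix ℤ n) → idM ⊗ M ≐ M
⊗-identityˡ M i j = *ᵥ-identityˡ (λ l → M l j) i

⊗-identityʳ : (M : Matrix ℤ n) → M ⊗ idM ≐ M
⊗-identityʳ M i j =
  trans (sumℤ-cong (λ l → trans (ℤP.*-comm (M i l) (idM l j)) (cong (_* M i l) (idM-sym l j))))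
        (*ᵥ-identityˡ (M i) j)

⊗-congˡ : {M M′ : Matrix ℤ n} (N : Matrix ℤ n) → M ≐ M′ → M ⊗ N ≐ M′ ⊗ N
⊗-congˡ N M≐M′ i j = sumℤ-cong (λ l → cong (_* N l j) (M≐M′ i l))

⊗-congʳ : (M : Matrix ℤ n) {N N′ : Matrix ℤ n} → N ≐ N′ → M ⊗ N ≐ M ⊗ N′
⊗-congʳ M N≐N′ i j = sumℤ-cong (λ l → cong (M i l *_) (N≐N′ l j))

*ᵥ-inverse : (M N : Matrix ℤ n) → M ⊗ N ≐ idM → ∀ v → M *ᵥ N *ᵥ v ≗ v
*ᵥ-inverse M N MN≐I v i = begin
  (M *ᵥ N *ᵥ v) i      ≡⟨ *ᵥ-assoc M N v i ⟩
  ((M ⊗ N) *ᵥ v) i     ≡⟨ sumℤ-cong (λ j → cong (_* v j) (MN≐I i j)) ⟩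
  (idM *ᵥ v) i         ≡⟨ *ᵥ-identityˡ v i ⟩
  v i                  ∎
  where open ≡-Reasoning

sumℤ-*ᵥ : (M : Matrix ℤ n) (v : Vector ℤ n) →
          sumℤ (M *ᵥ v) ≡ sumℤ (λ j → sumℤ (λ i → M i j) * v j)
sumℤ-*ᵥ M v = trans (sumℤ-comm (λ i j → M i j * v j))
                    (sumℤ-cong (λ j → sym (sumℤ-distribʳ (v j) (λ i → M i j))))

inverseʳ⇒inverseˡ : {M N P : Matrix ℤ n} → M ⊗ N ≐ idM → N ⊗ P ≐ idM → N ⊗ M ≐ idM
inverseʳ⇒inverseˡ {M = M} {N} {P} MN≐I NP≐I i j = begin
  (N ⊗ M) i j   ≡⟨ ⊗-congʳ N M≐P i j ⟩
  (N ⊗ P) i j   ≡⟨ NP≐I i j ⟩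
  idM i j       ∎
  where
  open ≡-Reasoning
  M≐P : M ≐ P
  M≐P i j = begin
    M i j                 ≡⟨ ⊗-identityʳ M i j ⟨
    (M ⊗ idM) i j         ≡⟨ ⊗-congʳ M NP≐I i j ⟨
    (M ⊗ (N ⊗ P)) i j     ≡⟨ ⊗-assoc M N P i j ⟨
    ((M ⊗ N) ⊗ P) i j     ≡⟨ ⊗-congˡ P MN≐I i j ⟩
    (idM ⊗ P) i j         ≡⟨ ⊗-identityˡ P i j ⟩
    P i j                 ∎

IsUnitriangular : Matrix ℤ n → Set
IsUnitriangular M = (∀ i j → toℕ j < toℕ i → M i j ≡ 0ℤ) × (∀ i → M i i ≡ 1ℤ)

toℤM-unitriangular : {B : Matrix ℕ n} → UpperUnitriangular B → IsUnitriangular (toℤM B)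
toℤM-unitriangular (lower , diag) = (λ i j j<i → cong +_ (lower i j j<i)) , cong +_ ∘ diag

minor : Matrix ℤ (suc n) → Matrix ℤ n
minor M i j = M (suc i) (suc j)

minor-unitriangular : {M : Matrix ℤ (suc n)} → IsUnitriangular M → IsUnitriangular (minor M)
minor-unitriangular (lower , diag) = (λ i j j<i → lower (suc i) (suc j) (s≤s j<i)) , diag ∘ suc

-- For unitriangular M = [1 r; 0 M′] this is [1 -r M′⁻¹; 0 M′⁻¹].
inverse : Matrix ℤ n → Matrix ℤ n
inverse {suc n} M zero zero = 1ℤ
inverse {suc n} M zero (suc j) = - sumℤ (λ l → M zero (suc l) * inverse (minor M) l j)
inverse {suc n} M (suc i) zero = 0ℤ
inverse {suc n} M (suc i) (suc j) = inverse (minor M) i j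

inverse-unitriangular : (M : Matrix ℤ n) → IsUnitriangular (inverse M)
inverse-unitriangular M = lower M , diag M
  where
  lower : (M : Matrix ℤ n) → ∀ i j → toℕ j < toℕ i → inverse M i j ≡ 0ℤ
  lower {suc n} M (suc i) zero _ = refl
  lower {suc n} M (suc i) (suc j) (s≤s j<i) = lower (minor M) i j j<i
  diag : (M : Matrix ℤ n) → ∀ i → inverse M i i ≡ 1ℤ
  diag {suc n} M zero = refl
  diag {suc n} M (suc i) = diag (minor M) i

⊗-inverseʳ : {M : Matrix ℤ n} → IsUnitriangular M → M ⊗ inverse M ≐ idM
⊗-inverseʳ {suc n} {M} (lower , diag) zero zero =
  cong₂ _+_ (trans (ℤP.*-identityʳ (M zero zero)) (diag zero)) (sumℤ-*-zeroʳ (M zero ∘ suc))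
⊗-inverseʳ {suc n} {M} (lower , diag) zero (suc j) = begin
  M zero zero * - s + s   ≡⟨ cong (λ x → x * - s + s) (diag zero) ⟩
  1ℤ * - s + s            ≡⟨ cong (_+ s) (ℤP.*-identityˡ (- s)) ⟩
  - s + s                 ≡⟨ ℤP.+-inverseˡ s ⟩
  0ℤ                      ∎
  where
  open ≡-Reasoning
  s : ℤ
  s = sumℤ (λ l → M zero (suc l) * inverse (minor M) l j)
⊗-inverseʳ {suc n} {M} (lower , diag) (suc i) zero =
  cong₂ _+_ (trans (ℤP.*-identityʳ (M (suc i) zero)) (lower (suc i) zero (s≤s z≤n)))
            (sumℤ-*-zeroʳ (M (suc i) ∘ suc))
⊗-inverseʳ {suc n} {M} M-unitri@(lower , diag) (suc i) (suc j) = begin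
  M (suc i) zero * inverse M zero (suc j) + rest
    ≡⟨ cong (λ x → x * inverse M zero (suc j) + rest) (lower (suc i) zero (s≤s z≤n)) ⟩
  0ℤ * inverse M zero (suc j) + rest
    ≡⟨ ℤP.+-identityˡ rest ⟩
  (minor M ⊗ inverse (minor M)) i j
    ≡⟨ ⊗-inverseʳ (minor-unitriangular M-unitri) i j ⟩
  idM i j
    ≡⟨ idM-suc i j ⟨
  idM (suc i) (suc j) ∎
  where
  open ≡-Reasoning
  rest : ℤ
  rest = (minor M ⊗ inverse (minor M)) i j

⊗-inverseˡ : {M : Matrix ℤ n} → IsUnitriangular M → inverse M ⊗ M ≐ idM
⊗-inverseˡ {M = M} M-unitri =
  inverseʳ⇒inverseˡ {M = M} {inverse M} {inverse (inverse M)}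
                    (⊗-inverseʳ M-unitri) (⊗-inverseʳ (inverse-unitriangular M))

aboveDiagonal : Matrix ℤ n → Vector ℤ n → Fin n → Fin n → ℤ
aboveDiagonal A v i j = if ⌊ toℕ i <? toℕ j ⌋ then A i j * v j else 0ℤ

unitriangular-term : {N : Matrix ℤ n} → IsUnitriangular N → ∀ v i j →
                     N i j * v j ≡ idM i j * v j - aboveDiagonal (idM ⊖ N) v i j
unitriangular-term {N = N} (lower , diag) v i j with toℕ i <? toℕ j
... | yes i<j rewrite idM-offdiag (FinP.<⇒≢ i<j) = solve (N i j) (v j)
  where
  solve : ∀ a x → a * x ≡ 0ℤ * x - (0ℤ - a) * x
  solve = solve-∀
... | no i≮j with i ≟ j
...   | yes refl rewrite diag i = sym (ℤP.+-identityʳ _)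
...   | no i≢j
  rewrite lower i j (ℕP.≤∧≢⇒< (ℕP.≮⇒≥ i≮j) (i≢j ∘ sym ∘ FinP.toℕ-injective)) =
  sym (trans (ℤP.+-identityʳ _) (ℤP.*-zeroˡ (v j)))

*ᵥ-unitriangular : {N : Matrix ℤ n} → IsUnitriangular N → ∀ v i →
                   (N *ᵥ v) i ≡ v i - sumℤ (aboveDiagonal (idM ⊖ N) v i)
*ᵥ-unitriangular {n = n} {N = N} N-unitri v i = begin
  sumℤ (λ j → N i j * v j)             ≡⟨ sumℤ-cong (unitriangular-term N-unitri v i) ⟩
  sumℤ (λ j → idM i j * v j + - T j)   ≡⟨ sumℤ-distrib-+ (λ j → idM i j * v j) (-_ ∘ T) ⟩
  (idM *ᵥ v) i + sumℤ (-_ ∘ T)         ≡⟨ cong₂ _+_ (*ᵥ-identityˡ v i) (sym (sumℤ-neg T)) ⟩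
  v i - sumℤ T                         ∎
  where
  open ≡-Reasoning
  T : Vector ℤ n
  T = aboveDiagonal (idM ⊖ N) v i

InP⇔*ᵥ-nonneg : {N : Matrix ℤ n} → IsUnitriangular N → (lam : Vec ℤ n) →
                InP (idM ⊖ N) lam ⇔ (∀ i → 0ℤ ℤ.≤ (N *ᵥ lookup lam) i)
InP⇔*ᵥ-nonneg N-unitri lam = mk⇔
  (λ lam∈P i → subst (0ℤ ℤ.≤_) (sym (Nlam≡ i)) (ℤP.i≤j⇒0≤j-i (lam∈P i)))
  (λ Nlam≥0 i → ℤP.0≤i-j⇒j≤i (subst (0ℤ ℤ.≤_) (Nlam≡ i) (Nlam≥0 i)))
  where Nlam≡ = *ᵥ-unitriangular N-unitri (lookup lam)

HasCard-map : {X Y : Set} {P : X → Set} {Q : Y → Set} {m : ℕ} (f : X → Y) →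
              Injective _≡_ _≡_ f → (∀ y → Q y ⇔ ∃ λ x → P x × f x ≡ y) → HasCard P m → HasCard Q m
HasCard-map {Q = Q} f f-injective Q⇔image (xs , |xs|≡m , xs-unique , P⇔∈xs) =
  map f xs , trans (ListP.length-map f xs) |xs|≡m , UniqueP.map⁺ f-injective xs-unique ,
  λ y → mk⇔ (to y) (from y)
  where
  to : ∀ y → Q y → y ∈ map f xs
  to y Qy with Equivalence.to (Q⇔image y) Qy
  ... | x , Px , refl = ∈P.∈-map⁺ f (Equivalence.to (P⇔∈xs x) Px)
  from : ∀ y → y ∈ map f xs → Q y
  from y y∈ with ∈P.∈-map⁻ f y∈
  ... | x , x∈xs , refl = Equivalence.from (Q⇔image y) (x , Equivalence.from (P⇔∈xs x) x∈xs , refl)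

weight : (Fin n → ℕ) → Vec ℕ n → ℕ
weight c μ = sumℕ (λ i → c i ℕ.* lookup μ i)

lookup≤weight : {c : Fin n → ℕ} → (∀ i → 1 ≤ c i) → ∀ μ i → lookup μ i ≤ weight c μ
lookup≤weight {c = c} c≥1 (x ∷ μ) zero =
  ℕP.≤-trans (ℕP.m≤n*m x (c zero) {{ℕ.>-nonZero (c≥1 zero)}}) (ℕP.m≤m+n _ _)
lookup≤weight c≥1 (x ∷ μ) (suc i) = ℕP.≤-trans (lookup≤weight (c≥1 ∘ suc) μ i) (ℕP.m≤n+m _ _)

boundedVecs : (n b : ℕ) → List (Vec ℕ n)
boundedVecs zero b = [] List.∷ List.[]
boundedVecs (suc n) b = cartesianProductWith _∷_ (upTo (suc b)) (boundedVecs n b)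

boundedVecs-unique : ∀ n b → Unique (boundedVecs n b)
boundedVecs-unique zero b = All.[] AllPairs.∷ AllPairs.[]
boundedVecs-unique (suc n) b =
  UniqueP.cartesianProductWith⁺ _∷_ VecP.∷-injective (UniqueP.upTo⁺ (suc b)) (boundedVecs-unique n b)

∈-boundedVecs : ∀ {b} (μ : Vec ℕ n) → (∀ i → lookup μ i ≤ b) → μ ∈ boundedVecs n b
∈-boundedVecs [] _ = here refl
∈-boundedVecs (x ∷ μ) μ≤b =
  ∈P.∈-cartesianProductWith⁺ _∷_ (∈P.∈-upTo⁺ (s≤s (μ≤b zero))) (∈-boundedVecs μ (μ≤b ∘ suc))

weight-hasCard : {c : Fin n → ℕ} → (∀ i → 1 ≤ c i) →
                 ∀ w → ∃ λ m → HasCard (λ μ → weight c μ ≡ w) m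
weight-hasCard {n} {c} c≥1 w =
  length μs , μs , refl , UniqueP.filter⁺ weight≟w (boundedVecs-unique n w) , λ μ → mk⇔ (to μ) (from μ)
  where
  weight≟w : (μ : Vec ℕ n) → Dec (weight c μ ≡ w)
  weight≟w μ = weight c μ ℕ.≟ w
  μs : List (Vec ℕ n)
  μs = filter weight≟w (boundedVecs n w)
  to : ∀ μ → weight c μ ≡ w → μ ∈ μs
  to μ wμ≡w = ∈P.∈-filter⁺ weight≟w (∈-boundedVecs μ μ≤w) wμ≡w
    where
    μ≤w : ∀ i → lookup μ i ≤ w
    μ≤w i = subst (lookup μ i ≤_) wμ≡w (lookup≤weight c≥1 μ i)
  from : ∀ μ → μ ∈ μs → weight c μ ≡ w
  from μ = proj₂ ∘ ∈P.∈-filter⁻ weight≟w {xs = boundedVecs n w}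

embed : Matrix ℕ n → Vec ℕ n → Vec ℤ n
embed B μ = tabulate (toℤM B *ᵥ +_ ∘ lookup μ)

lookup-embed : (B : Matrix ℕ n) (μ : Vec ℕ n) → lookup (embed B μ) ≗ toℤM B *ᵥ +_ ∘ lookup μ
lookup-embed B μ = VecP.lookup∘tabulate (toℤM B *ᵥ +_ ∘ lookup μ)

coordinates : Matrix ℕ n → Vec ℤ n → Vec ℕ n
coordinates B lam = tabulate (∣_∣ ∘ (inverse (toℤM B) *ᵥ lookup lam))

lookup-coordinates : (B : Matrix ℕ n) (lam : Vec ℤ n) →
                     lookup (coordinates B lam) ≗ ∣_∣ ∘ (inverse (toℤM B) *ᵥ lookup lam)
lookup-coordinates B lam = VecP.lookup∘tabulate (∣_∣ ∘ (inverse (toℤM B) *ᵥ lookup lam))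

sumℤ-embed : {B : Matrix ℕ n} {c : Fin n → ℕ} → (∀ j → sumℕ (λ i → B i j) ≡ c j) →
             ∀ μ → sumℤ (lookup (embed B μ)) ≡ + weight c μ
sumℤ-embed {n = n} {B = B} {c} colSum μ = begin
  sumℤ (lookup (embed B μ))
    ≡⟨ sumℤ-cong (lookup-embed B μ) ⟩
  sumℤ (toℤM B *ᵥ v)
    ≡⟨ sumℤ-*ᵥ (toℤM B) v ⟩
  sumℤ (λ j → sumℤ (λ i → + B i j) * + lookup μ j)
    ≡⟨ sumℤ-cong (λ j → cong (_* + lookup μ j) (colSumℤ j)) ⟩
  sumℤ (λ j → + c j * + lookup μ j)
    ≡⟨ sumℤ-cong (λ j → ℤP.pos-* (c j) (lookup μ j)) ⟨
  sumℤ (λ j → + (c j ℕ.* lookup μ j))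
    ≡⟨ sumℤ-pos (λ j → c j ℕ.* lookup μ j) ⟩
  + weight c μ ∎
  where
  open ≡-Reasoning
  v : Vector ℤ n
  v = +_ ∘ lookup μ
  colSumℤ : ∀ j → sumℤ (λ i → + B i j) ≡ + c j
  colSumℤ j = trans (sumℤ-pos (λ i → B i j)) (cong +_ (colSum j))

module _ {B : Matrix ℕ n} (B-unitri : UpperUnitriangular B) where

  private
    Bℤ-unitri : IsUnitriangular (toℤM B)
    Bℤ-unitri = toℤM-unitriangular B-unitri

  inverse-*ᵥ-embed : ∀ μ → inverse (toℤM B) *ᵥ lookup (embed B μ) ≗ +_ ∘ lookup μ
  inverse-*ᵥ-embed μ i =
    trans (sumℤ-cong (λ j → cong (inverse (toℤM B) i j *_) (lookup-embed B μ j)))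
          (*ᵥ-inverse (inverse (toℤM B)) (toℤM B) (⊗-inverseˡ Bℤ-unitri) (+_ ∘ lookup μ) i)

  coordinates∘embed : ∀ μ → coordinates B (embed B μ) ≡ μ
  coordinates∘embed μ =
    trans (VecP.tabulate-cong (cong ∣_∣ ∘ inverse-*ᵥ-embed μ)) (VecP.tabulate∘lookup μ)

  embed∘coordinates : ∀ lam → (∀ i → 0ℤ ℤ.≤ (inverse (toℤM B) *ᵥ lookup lam) i) →
                      embed B (coordinates B lam) ≡ lam
  embed∘coordinates lam B⁻¹lam≥0 =
    trans (VecP.tabulate-cong (λ i → trans (sumℤ-cong (λ j → cong (toℤM B i j *_) (entry j)))
                                           (*ᵥ-inverse (toℤM B) (inverse (toℤM B)) B⊗B⁻¹≐I (lookup lam) i)))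
          (VecP.tabulate∘lookup lam)
    where
    B⊗B⁻¹≐I : toℤM B ⊗ inverse (toℤM B) ≐ idM
    B⊗B⁻¹≐I = ⊗-inverseʳ Bℤ-unitri
    entry : ∀ j → + lookup (coordinates B lam) j ≡ (inverse (toℤM B) *ᵥ lookup lam) j
    entry j = trans (cong +_ (lookup-coordinates B lam j)) (ℤP.0≤i⇒+∣i∣≡i (B⁻¹lam≥0 j))

  embed-injective : Injective _≡_ _≡_ (embed B)
  embed-injective {μ} {μ′} eq = begin
    μ                            ≡⟨ coordinates∘embed μ ⟨
    coordinates B (embed B μ)    ≡⟨ cong (coordinates B) eq ⟩
    coordinates B (embed B μ′)   ≡⟨ coordinates∘embed μ′ ⟩
    μ′                           ∎
    where open ≡-Reasoning

  InP×weight⇔∃embed : ∀ {c : Fin n → ℕ} → (∀ j → sumℕ (λ i → B i j) ≡ c j) → ∀ w lam →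
                      (InP (idM ⊖ inverse (toℤM B)) lam × sumℤ (lookup lam) ≡ + w) ⇔
                      ∃ λ μ → weight c μ ≡ w × embed B μ ≡ lam
  InP×weight⇔∃embed {c} colSum w lam = mk⇔ to from
    where
    InP⇔ : ∀ lam → InP (idM ⊖ inverse (toℤM B)) lam ⇔
                   (∀ i → 0ℤ ℤ.≤ (inverse (toℤM B) *ᵥ lookup lam) i)
    InP⇔ = InP⇔*ᵥ-nonneg (inverse-unitriangular (toℤM B))
    to : InP (idM ⊖ inverse (toℤM B)) lam × sumℤ (lookup lam) ≡ + w →
         ∃ λ μ → weight c μ ≡ w × embed B μ ≡ lam
    to (lam∈P , |lam|≡w) =
      coordinates B lam ,
      ℤP.+-injective (trans (sym (sumℤ-embed colSum (coordinates B lam)))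
                            (trans (cong (sumℤ ∘ lookup) embed≡lam) |lam|≡w)) ,
      embed≡lam
      where
      embed≡lam : embed B (coordinates B lam) ≡ lam
      embed≡lam = embed∘coordinates lam (Equivalence.to (InP⇔ lam) lam∈P)
    from : (∃ λ μ → weight c μ ≡ w × embed B μ ≡ lam) →
           InP (idM ⊖ inverse (toℤM B)) lam × sumℤ (lookup lam) ≡ + w
    from (μ , wμ≡w , refl) =
      Equivalence.from (InP⇔ (embed B μ))
                       (λ i → subst (0ℤ ℤ.≤_) (sym (inverse-*ᵥ-embed μ i)) (ℤ.+≤+ z≤n)) ,
      trans (sumℤ-embed colSum μ) (cong +_ wμ≡w)

GFEq-columnSums : {B : Matrix ℕ n} {c : Fin n → ℕ} → UpperUnitriangular B → (∀ i → 1 ≤ c i) →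
                  (∀ j → sumℕ (λ i → B i j) ≡ c j) → GFEq (idM ⊖ inverse (toℤM B)) c
GFEq-columnSums {B = B} B-unitri c≥1 colSum w =
  let m , weight≡w-hasCard = weight-hasCard c≥1 w in
  m , HasCard-map (embed B) (embed-injective B-unitri) (InP×weight⇔∃embed B-unitri colSum w)
                  weight≡w-hasCard ,
      weight≡w-hasCard

pascalSplit : (a m : ℕ) → Fin (suc a C suc m) → Fin (a C m) ⊎ Fin (a C suc m)
pascalSplit a m = splitAt (a C m) ∘ subst Fin (sym (nCk+nC[k+1]≡[n+1]C[k+1] a m))

pascalSplit-injective : ∀ a m → Injective _≡_ _≡_ (pascalSplit a m)
pascalSplit-injective a m =
  subst-injective (sym (nCk+nC[k+1]≡[n+1]C[k+1] a m)) ∘ Injection.injective (↔⇒↣ FinP.+↔⊎)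

updateAt-zero-suc-injective : {u v : Vector ℕ (suc n)} →
                              updateAt u zero suc ≗ updateAt v zero suc → u ≗ v
updateAt-zero-suc-injective eq zero = ℕP.suc-injective (eq zero)
updateAt-zero-suc-injective eq (suc i) = eq (suc i)

-- column a m runs over the vectors v with v₀ ≥ 0, v₁, …, vₘ ≥ 1, vₘ₊₁ = 1, vᵢ = 0 beyond,
-- and sum a + 1. Pascal's rule binom(a + 1, m + 1) = binom(a, m) + binom(a, m + 1) splits
-- them by whether v₀ = 0 (drop it and decrease v₁) or v₀ ≥ 1 (decrease it).
column : (a m : ℕ) → suc m < n → Fin (a C m) → Vector ℕ n
column-⊎ : (a m : ℕ) → suc m < n → Fin (a C m) ⊎ Fin (a C suc m) → Vector ℕ (suc n)

column a zero (s≤s (s≤s _)) _ zero = a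
column a zero (s≤s (s≤s _)) _ (suc zero) = 1
column a zero (s≤s (s≤s _)) _ (suc (suc _)) = 0
column zero (suc m) _ ()
column (suc a) (suc m) (s≤s m+1<n) = column-⊎ a m m+1<n ∘ pascalSplit a m

column-⊎ a m m+1<n (inj₂ x) = updateAt (column a (suc m) (s≤s m+1<n) x) zero suc
column-⊎ a m (s≤s (s≤s _)) (inj₁ x) zero = 0
column-⊎ a m m+1<n@(s≤s (s≤s _)) (inj₁ x) (suc i) = updateAt (column a m m+1<n x) zero suc i

column-sum : ∀ a m (m+1<n : suc m < n) x → sumℕ (column a m m+1<n x) ≡ a ℕ.+ 1
column-⊎-sum : ∀ a m (m+1<n : suc m < n) s → sumℕ (column-⊎ a m m+1<n s) ≡ suc a ℕ.+ 1

column-sum a zero (s≤s (s≤s {n = n} _)) _ = cong (λ s → a ℕ.+ suc s) (sumℕ-zero {n})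
column-sum zero (suc m) _ ()
column-sum (suc a) (suc m) (s≤s m+1<n) x = column-⊎-sum a m m+1<n (pascalSplit a m x)

column-⊎-sum a m m+1<n@(s≤s (s≤s _)) (inj₁ x) = cong suc (column-sum a m m+1<n x)
column-⊎-sum a m m+1<n (inj₂ x) = cong suc (column-sum a (suc m) (s≤s m+1<n) x)

column-one : ∀ a m (m+1<n : suc m < n) x i → toℕ i ≡ suc m → column a m m+1<n x i ≡ 1
column-⊎-one : ∀ a m (m+1<n : suc m < n) s i →
               toℕ i ≡ suc (suc m) → column-⊎ a m m+1<n s i ≡ 1

column-one a zero (s≤s (s≤s _)) _ (suc zero) _ = refl
column-one zero (suc m) _ ()
column-one (suc a) (suc m) (s≤s m+1<n) x = column-⊎-one a m m+1<n (pascalSplit a m x)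

column-⊎-one a m m+1<n@(s≤s (s≤s _)) (inj₁ x) (suc (suc i)) i≡m+2 =
  column-one a m m+1<n x (suc i) (ℕP.suc-injective i≡m+2)
column-⊎-one a m m+1<n (inj₂ x) (suc i) i≡m+2 =
  column-one a (suc m) (s≤s m+1<n) x (suc i) i≡m+2

column-zero : ∀ a m (m+1<n : suc m < n) x i → suc m < toℕ i → column a m m+1<n x i ≡ 0
column-⊎-zero : ∀ a m (m+1<n : suc m < n) s i →
                suc (suc m) < toℕ i → column-⊎ a m m+1<n s i ≡ 0

column-zero a zero (s≤s (s≤s _)) _ (suc (suc i)) _ = refl
column-zero a zero (s≤s (s≤s _)) _ (suc zero) (s≤s ())
column-zero zero (suc m) _ ()
column-zero (suc a) (suc m) (s≤s m+1<n) x = column-⊎-zero a m m+1<n (pascalSplit a m x)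

column-⊎-zero a m m+1<n@(s≤s (s≤s _)) (inj₁ x) (suc (suc i)) (s≤s m+2<i+1) =
  column-zero a m m+1<n x (suc i) m+2<i+1
column-⊎-zero a m m+1<n (inj₂ x) (suc i) m+2<i+1 =
  column-zero a (suc m) (s≤s m+1<n) x (suc i) m+2<i+1

column-injective : ∀ a m (m+1<n : suc m < n) x y →
                   column a m m+1<n x ≗ column a m m+1<n y → x ≡ y
column-⊎-injective : ∀ a m (m+1<n : suc m < n) s t →
                     column-⊎ a m m+1<n s ≗ column-⊎ a m m+1<n t → s ≡ t

column-injective a zero (s≤s (s≤s _)) zero zero _ = refl
column-injective zero (suc m) _ ()
column-injective (suc a) (suc m) (s≤s m+1<n) x y eq =
  pascalSplit-injective a m (column-⊎-injective a m m+1<n (pascalSplit a m x) (pascalSplit a m y) eq)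

column-⊎-injective a m m+1<n@(s≤s (s≤s _)) (inj₁ x) (inj₁ y) eq =
  cong inj₁ (column-injective a m m+1<n x y (updateAt-zero-suc-injective (eq ∘ suc)))
column-⊎-injective a m (s≤s (s≤s _)) (inj₁ x) (inj₂ y) eq = contradiction (eq zero) λ ()
column-⊎-injective a m (s≤s (s≤s _)) (inj₂ x) (inj₁ y) eq = contradiction (eq zero) λ ()
column-⊎-injective a m m+1<n (inj₂ x) (inj₂ y) eq =
  cong inj₂ (column-injective a (suc m) (s≤s m+1<n) x y (updateAt-zero-suc-injective eq))

unprod : {k : ℕ} (f : Fin k → ℕ) → Fin (prodℕ f) → (j : Fin k) → Fin (f j)
unprod f x zero = proj₁ (remQuot {f zero} (prodℕ (f ∘ suc)) x)
unprod f x (suc j) = unprod (f ∘ suc) (proj₂ (remQuot {f zero} (prodℕ (f ∘ suc)) x)) j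

unprod-injective : {k : ℕ} (f : Fin k → ℕ) {x y : Fin (prodℕ f)} →
                   (∀ j → unprod f x j ≡ unprod f y j) → x ≡ y
unprod-injective {zero} f {zero} {zero} _ = refl
unprod-injective {suc k} f eq =
  Injection.injective (↔⇒↣ (FinP.*↔× {f zero} {prodℕ (f ∘ suc)}))
                      (cong₂ _,_ (eq zero) (unprod-injective (f ∘ suc) (eq ∘ suc)))

module _ {k : ℕ} (c : Fin (suc k) → ℕ) where

  private
    columnSize : Fin k → ℕ
    columnSize j = (c (suc j) ∸ 1) C toℕ j

    j+1<k+1 : (j : Fin k) → suc (toℕ j) < suc k
    j+1<k+1 j = s≤s (FinP.toℕ<n j)

  binomialMatrix : Fin (binomProd c) → Matrix ℕ (suc k)
  binomialMatrix x i (suc j) = column (c (suc j) ∸ 1) (toℕ j) (j+1<k+1 j) (unprod columnSize x j) i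
  binomialMatrix x zero zero = 1
  binomialMatrix x (suc i) zero = 0

  binomialMatrix-unitriangular : ∀ x → UpperUnitriangular (binomialMatrix x)
  binomialMatrix-unitriangular x = lower , diag
    where
    lower : ∀ i j → toℕ j < toℕ i → binomialMatrix x i j ≡ 0
    lower i (suc j) = column-zero (c (suc j) ∸ 1) (toℕ j) (j+1<k+1 j) (unprod columnSize x j) i
    lower (suc i) zero _ = refl
    diag : ∀ i → binomialMatrix x i i ≡ 1
    diag zero = refl
    diag (suc j) = column-one (c (suc j) ∸ 1) (toℕ j) (j+1<k+1 j) (unprod columnSize x j) (suc j) refl

  binomialMatrix-columnSum : (∀ i → 1 ≤ c i) → c zero ≡ 1 →
                             ∀ x j → sumℕ (λ i → binomialMatrix x i j) ≡ c j
  binomialMatrix-columnSum c≥1 c₀≡1 x zero = trans (cong suc (sumℕ-zero {k})) (sym c₀≡1)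
  binomialMatrix-columnSum c≥1 c₀≡1 x (suc j) =
    trans (column-sum (c (suc j) ∸ 1) (toℕ j) (j+1<k+1 j) (unprod columnSize x j))
          (ℕP.m∸n+n≡m (c≥1 (suc j)))

  binomialMatrix-injective : ∀ {x y} → (∀ i j → binomialMatrix x i j ≡ binomialMatrix y i j) →
                             x ≡ y
  binomialMatrix-injective {x} {y} eq = unprod-injective columnSize (λ j →
    column-injective (c (suc j) ∸ 1) (toℕ j) (j+1<k+1 j) (unprod columnSize x j) (unprod columnSize y j)
                     (λ i → eq i (suc j)))

proposition1 : (k : ℕ) (c : Fin (suc k) → ℕ) → (∀ i → 1 ≤ c i) → c zero ≡ 1 →
    Σ (Fin (binomProd c) → Matrix ℕ (suc k)) (λ Bs →
      (∀ a b → (∀ i j → Bs a i j ≡ Bs b i j) → a ≡ b) ×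
      (∀ a → UpperUnitriangular (Bs a) ×
        Σ (Matrix ℤ (suc k)) (λ Binv → IsInverse (toℤM (Bs a)) Binv × GFEq (idM ⊖ Binv) c)))
proposition1 k c c≥1 c₀≡1 =
  binomialMatrix c , (λ _ _ → binomialMatrix-injective c) , λ x →
    let B-unitri = binomialMatrix-unitriangular c x
        Bℤ-unitri = toℤM-unitriangular B-unitri
    in B-unitri , inverse (toℤM (binomialMatrix c x)) , (⊗-inverseʳ Bℤ-unitri , ⊗-inverseˡ Bℤ-unitri) ,
       GFEq-columnSums B-unitri c≥1 (binomialMatrix-columnSum c c≥1 c₀≡1 x)
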